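{- Let $H$ and $G$ be graphs and let $k\geq 1$ be an integer. Suppose $H$ is uniquely $k$-$G$-free colourable, $|V(G)|=m$ and $\delta(G)=\delta$. If a vertex $v$ of $H$ satisfies $\deg_H(v)=(k-1)\delta$ and the colour class of $v$ in the unique $G$-free $k$-colouring contains more than $m$ vertices, then $H\setminus\{v\}$ is also uniquely $k$-$G$-free colourable.
   Context: All graphs are finite, simple and undirected; $\delta(G)$ denotes the minimum degree of $G$. For a graph $G$ on at least 2 vertices, a $G$-free $k$-colouring of a graph $H$ is a map $\pi:V(H)\to\{1,\dots,k\}$ such that for every $i$ the subgraph of $H$ induced by $\pi^{ -1}(i)$ contains no subgraph isomorphic to $G$. The $G$-free chromatic number $\chi_G(H)$ is the least $k$ for which a $G$-free $k$-colouring of $H$ exists. $H$ is uniquely $k$-$G$-free colourable if $\chi_G(H)=k$ and every $G$-free $k$-colouring of $H$ produces the same partition of $V(H)$ into colour classes. -}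

module Defs where

open import Data.Nat using (ℕ; zero; suc; _+_; _≤_; _<_)
open import Data.Fin using (Fin; zero; suc; punchIn)
open import Data.Bool using (Bool; true; false; if_then_else_)
open import Data.Product using (Σ; ∃; _×_; _,_)
open import Relation.Nullary using (¬_)
open import Relation.Binary.PropositionalEquality using (_≡_)
open import Function.Definitions using (Injective)
open import Data.Fin.Properties using (_≟_)
open import Relation.Nullary.Decidable using (⌊_⌋)

record Graph : Set where
  field
    n      : ℕ
    adj    : Fin n → Fin n → Bool
    sym    : ∀ u w → adj u w ≡ adj w u
    irrefl : ∀ u → adj u u ≡ false

open Graph public

Vertex : Graph → Set
Vertex H = Fin (n H)

countTrue : (k : ℕ) → (Fin k → Bool) → ℕ
countTrue zero    p = 0
countTrue (suc k) p = (if p zero then 1 else 0) + countTrue k (λ x → p (suc x))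

degree : (H : Graph) → Vertex H → ℕ
degree H v = countTrue (n H) (adj H v)

IsMinDegree : Graph → ℕ → Set
IsMinDegree G d = (∀ u → d ≤ degree G u) × ∃ λ u → degree G u ≡ d

Colouring : Graph → ℕ → Set
Colouring H k = Vertex H → Fin k

SubgraphInClass : (G H : Graph) {k : ℕ} → Colouring H k → Fin k → Set
SubgraphInClass G H π i =
  Σ (Vertex G → Vertex H) λ f →
    Injective _≡_ _≡_ f
    × (∀ x → π (f x) ≡ i)
    × (∀ x y → adj G x y ≡ true → adj H (f x) (f y) ≡ true)

IsGFreeColouring : (G H : Graph) {k : ℕ} → Colouring H k → Set
IsGFreeColouring G H π = ∀ i → ¬ SubgraphInClass G H π i

HasGFreeColouring : (G H : Graph) → ℕ → Set
HasGFreeColouring G H k = Σ (Colouring H k) (IsGFreeColouring G H)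

GFreeChromaticNumberIs : (G H : Graph) → ℕ → Set
GFreeChromaticNumberIs G H k =
  HasGFreeColouring G H k × (∀ j → j < k → ¬ HasGFreeColouring G H j)

UniquelyGFreeColourable : (G H : Graph) → ℕ → Set
UniquelyGFreeColourable G H k =
  GFreeChromaticNumberIs G H k ×
  (∀ (π π′ : Colouring H k) → IsGFreeColouring G H π → IsGFreeColouring G H π′ →
     ∀ u w → (π u ≡ π w → π′ u ≡ π′ w) × (π′ u ≡ π′ w → π u ≡ π w))

classSize : (H : Graph) {k : ℕ} → Colouring H k → Vertex H → ℕ
classSize H π v = countTrue (n H) (λ u → ⌊ π u ≟ π v ⌋)

private
  delete : (m : ℕ) (a : Fin m → Fin m → Bool) →
           (∀ u w → a u w ≡ a w u) → (∀ u → a u u ≡ false) → Fin m → Graph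
  delete (suc m) a s i v = record
    { n = m
    ; adj = λ x y → a (punchIn v x) (punchIn v y)
    ; sym = λ x y → s (punchIn v x) (punchIn v y)
    ; irrefl = λ x → i (punchIn v x) }

deleteVertex : (H : Graph) → Vertex H → Graph
deleteVertex H v = delete (n H) (adj H) (sym H) (irrefl H) v

{-# OPTIONS --safe #-}
-- Let π be the unique G-free k-colouring of H. Every G-free k-colouring σ of H ∖ v extends to a
-- G-free colouring of H by some colour for v, and uniqueness in H then forces σ to induce the
-- partition of π. If no colour c worked, each class c of σ together with v would contain a copy of G
-- through v. For δ > 0 the vertex mapped to v has δ neighbours, all adjacent to v and of colour c,
-- so deg v ≥ kδ > (k − 1)δ. For δ = 0 the vertex v is isolated, so such a copy can be moved onto any
-- vertex of class c it misses, and |H ∖ v| ≤ k(m − 1); but uniqueness also forbids extending π|H∖v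
-- by any colour d ≠ π v, so such copies exist for π too, and together with the big class of v they
-- give |H ∖ v| ≥ k(m − 1) + 1. A G-free colouring of H ∖ v with fewer colours, extended by a fresh
-- colour for v, would leave v alone in its class, so χ_G(H ∖ v) = k.
module Submission where

open import Defs
open import Data.Nat using (ℕ; _≤_; _<_; _*_; _∸_)
open import Relation.Binary.PropositionalEquality using (_≡_)

open import Data.Nat using (zero; suc; z≤n; s≤s)
open import Data.Nat.Properties using (≤-trans; <⇒≤; <⇒≱; <-irrefl; n<1+n; 1+n≰n; *-zeroʳ; *-monoˡ-<)
open import Data.Fin using (Fin; zero; suc; toℕ; inject≤; fromℕ<; punchIn; punchOut; remQuot; combine)
open import Data.Fin.Properties
  using (_≟_; suc-injective; injective⇒≤; inject≤-injective; toℕ-inject≤; toℕ-fromℕ<; toℕ<n;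
         combine-remQuot; combine-injective; punchIn-injective; punchInᵢ≢i; punchOut-cong;
         punchOut-injective; punchOut-punchIn; punchIn-punchOut; any?)
open import Data.Vec.Functional using (_∷_)
open import Data.Bool using (Bool; true; false)
open import Data.Bool.Properties using (T-≡)
open import Data.Product using (Σ; ∃; _×_; _,_; proj₁; proj₂; uncurry)
open import Function using (_∘_; Injective; Equivalence)
open import Relation.Nullary using (¬_; Dec; yes; no)
open import Relation.Nullary.Negation using (¬¬-map; contradiction)
open import Relation.Nullary.Decidable using (toWitness; decidable-stable)
open import Relation.Binary.PropositionalEquality as ≡ using (refl; trans; cong; subst; subst₂; _≢_)

record Enumeration {n : ℕ} (p : Fin n → Bool) (c : ℕ) : Set where
  field
    element   : Fin c → Fin n
    injective : Injective _≡_ _≡_ element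
    sound     : ∀ i → p (element i) ≡ true
    complete  : ∀ x → p x ≡ true → ∃ λ i → element i ≡ x

∷-injective : ∀ {n} {A : Set} {x : A} {f : Fin n → A} →
  (∀ i → f i ≢ x) → Injective _≡_ _≡_ f → Injective _≡_ _≡_ (x ∷ f)
∷-injective fresh f-inj {zero}  {zero}  _  = refl
∷-injective fresh f-inj {zero}  {suc j} eq = contradiction (≡.sym eq) (fresh j)
∷-injective fresh f-inj {suc i} {zero}  eq = contradiction eq (fresh i)
∷-injective fresh f-inj {suc i} {suc j} eq = cong suc (f-inj eq)

enumerate : ∀ n (p : Fin n → Bool) → Enumeration p (countTrue n p)
enumerate zero    p = record { element = λ () ; injective = λ {} ; sound = λ () ; complete = λ () }
enumerate (suc n) p with p zero in p₀ | enumerate n (p ∘ suc)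
... | true  | e = record
  { element   = zero ∷ suc ∘ element
  ; injective = ∷-injective (λ _ ()) (injective ∘ suc-injective)
  ; sound     = λ { zero → p₀ ; (suc i) → sound i }
  ; complete  = λ { zero _ → zero , refl
                  ; (suc x) px → let i , eq = complete x px in suc i , cong suc eq } }
  where open Enumeration e
... | false | e = record
  { element   = suc ∘ element
  ; injective = injective ∘ suc-injective
  ; sound     = sound
  ; complete  = λ { zero px → contradiction (trans (≡.sym p₀) px) λ ()
                  ; (suc x) px → let i , eq = complete x px in i , cong suc eq } }
  where open Enumeration e

module _ {n : ℕ} (p : Fin n → Bool) where
  open Enumeration (enumerate n p)

  injective⇒≤countTrue : ∀ {a} (f : Fin a → Fin n) → Injective _≡_ _≡_ f →
    (∀ i → p (f i) ≡ true) → a ≤ countTrue n p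
  injective⇒≤countTrue f f-inj pf = injective⇒≤ {f = index} index-inj
    where
    index : _ → Fin (countTrue n p)
    index i = proj₁ (complete (f i) (pf i))
    index-inj : Injective _≡_ _≡_ index
    index-inj {i} {j} eq = f-inj (trans (≡.sym (proj₂ (complete (f i) (pf i))))
                           (trans (cong element eq) (proj₂ (complete (f j) (pf j)))))

  ≤countTrue⇒injection : ∀ {a} → a ≤ countTrue n p →
    Σ (Fin a → Fin n) λ f → Injective _≡_ _≡_ f × (∀ i → p (f i) ≡ true)
  ≤countTrue⇒injection a≤c =
    (λ i → element (inject≤ i a≤c)) ,
    (λ eq → inject≤-injective a≤c a≤c _ _ (injective eq)) ,
    (λ i → sound (inject≤ i a≤c))

  countTrue≤1 : (∀ x y → p x ≡ true → p y ≡ true → x ≡ y) → countTrue n p ≤ 1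
  countTrue≤1 unique = injective⇒≤ {f = λ _ → zero {0}}
    (λ {i} {j} _ → injective (unique _ _ (sound i) (sound j)))

¬¬-Π-Fin : ∀ k {P : Fin k → Set} → (∀ c → ¬ ¬ P c) → ¬ ¬ (∀ c → P c)
¬¬-Π-Fin zero    ¬¬P ¬∀ = ¬∀ λ ()
¬¬-Π-Fin (suc k) ¬¬P ¬∀ =
  ¬¬P zero λ P₀ → ¬¬-Π-Fin k (¬¬P ∘ suc) λ P₊ → ¬∀ λ { zero → P₀ ; (suc c) → P₊ c }

*-pred-< : ∀ {k} δ → 1 ≤ k → (k ∸ 1) * suc δ < k * suc δ
*-pred-< {suc k} δ _ = *-monoˡ-< (suc δ) (n<1+n k)

rows-injective : ∀ {k M} {X : Set} (F : Fin k → Fin M → X) →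
  (∀ {c c′ j j′} → F c j ≡ F c′ j′ → c ≡ c′) → (∀ c → Injective _≡_ _≡_ (F c)) →
  Injective _≡_ _≡_ (uncurry F ∘ remQuot {k} M)
rows-injective {k} {M} F disjoint row-injective {i} {i′} eq = begin
  i                                 ≡⟨ combine-remQuot {k} M i ⟨
  uncurry combine (remQuot {k} M i)  ≡⟨ cong (uncurry combine) (pair-injective eq) ⟩
  uncurry combine (remQuot {k} M i′) ≡⟨ combine-remQuot {k} M i′ ⟩
  i′                                ∎
  where
  open ≡.≡-Reasoning
  pair-injective : ∀ {a b} → uncurry F a ≡ uncurry F b → a ≡ b
  pair-injective {c , j} {c′ , j′} eq with refl ← disjoint eq = cong (c ,_) (row-injective c eq)

module _ (H : Graph) {k} (π : Colouring H k) (v : Vertex H) where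

  classMembers : ∀ {a} → a ≤ classSize H π v →
    Σ (Fin a → Vertex H) λ f → Injective _≡_ _≡_ f × (∀ i → π (f i) ≡ π v)
  classMembers a≤ with f , f-injective , f-class ← ≤countTrue⇒injection _ a≤ =
    f , f-injective , λ i → toWitness {a? = π (f i) ≟ π v} (Equivalence.from T-≡ (f-class i))

  classSize≤1 : (∀ u → π u ≡ π v → u ≡ v) → classSize H π v ≤ 1
  classSize≤1 alone = countTrue≤1 _ λ x y px py →
    trans (alone x (toWitness {a? = π x ≟ π v} (Equivalence.from T-≡ px)))
          (≡.sym (alone y (toWitness {a? = π y ≟ π v} (Equivalence.from T-≡ py))))

inject≤≢fromℕ< : ∀ {j k} (i : Fin j) (j<k : j < k) → inject≤ i (<⇒≤ j<k) ≢ fromℕ< j<k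
inject≤≢fromℕ< {j} i j<k eq = <-irrefl (begin
  toℕ i                     ≡⟨ toℕ-inject≤ i (<⇒≤ j<k) ⟨
  toℕ (inject≤ i (<⇒≤ j<k)) ≡⟨ cong toℕ eq ⟩
  toℕ (fromℕ< j<k)          ≡⟨ toℕ-fromℕ< j<k ⟩
  j                         ∎) (toℕ<n i)
  where open ≡.≡-Reasoning

inject≤-GFree : ∀ {G H : Graph} {j k} → Vertex G → (σ : Colouring H j) (j≤k : j ≤ k) →
  IsGFreeColouring G H σ → IsGFreeColouring G H (λ u → inject≤ (σ u) j≤k)
inject≤-GFree x₀ σ j≤k σ-free i (f , f-injective , f-class , f-adj) = σ-free (σ (f x₀))
  (f , f-injective , (λ x → inject≤-injective j≤k j≤k _ _ (trans (f-class x) (≡.sym (f-class x₀)))) ,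
   f-adj)

injective-avoids : ∀ {n m} (e : Fin (suc (suc n)) → Fin m) → Injective _≡_ _≡_ e →
  ∀ v → ∃ λ a → v ≢ e a
injective-avoids e e-injective v with v ≟ e zero
... | no v≢e₀  = zero , v≢e₀
... | yes v≡e₀ = suc zero , λ v≡e₁ → contradiction (e-injective (trans (≡.sym v≡e₀) v≡e₁)) λ ()

copy-in-singleton⇒≤1 : ∀ {G H : Graph} {k} {π : Colouring H k} {i} {v : Vertex H} →
  (∀ u → π u ≡ i → u ≡ v) → SubgraphInClass G H π i → n G ≤ 1
copy-in-singleton⇒≤1 alone (f , f-injective , f-class , _) = injective⇒≤ {f = λ _ → zero {0}}
  λ {x} {y} _ → f-injective (trans (alone (f x) (f-class x)) (≡.sym (alone (f y) (f-class y))))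

reembed-isolated : ∀ {G H : Graph} {k} {π : Colouring H k} {i}
  (s : SubgraphInClass G H π i) {x : Vertex G} → (∀ y → adj G x y ≢ true) →
  ∀ {w} → π w ≡ i → (∀ y → proj₁ s y ≢ w) →
  Σ (SubgraphInClass G H π i) λ s′ → proj₁ s′ x ≡ w × (∀ y → y ≢ x → proj₁ s′ y ≡ proj₁ s y)
reembed-isolated {G} {H} {π = π} {i} (f , f-injective , f-class , f-adj) {x} isolated {w} w-class unused
  =
  ((λ y → g (y ≟ x)) ,
   (λ {y} {y′} → g-injective (y ≟ x) (y′ ≟ x)) ,
   (λ y → g-class (y ≟ x)) ,
   (λ y y′ → g-adj (y ≟ x) (y′ ≟ x))) ,
  g-at (x ≟ x) ,
  (λ y y≢x → g-off (y ≟ x) y≢x)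
  where
  g : ∀ {y} → Dec (y ≡ x) → Vertex H
  g (yes _)    = w
  g {y} (no _) = f y
  g-at : (d : Dec (x ≡ x)) → g d ≡ w
  g-at (yes _)  = refl
  g-at (no x≢x) = contradiction refl x≢x
  g-off : ∀ {y} (d : Dec (y ≡ x)) → y ≢ x → g d ≡ f y
  g-off (yes y≡x) y≢x = contradiction y≡x y≢x
  g-off (no _)    _   = refl
  g-injective : ∀ {y y′} (d : Dec (y ≡ x)) (d′ : Dec (y′ ≡ x)) → g d ≡ g d′ → y ≡ y′
  g-injective (yes y≡x) (yes y′≡x) _ = trans y≡x (≡.sym y′≡x)
  g-injective (yes _)   (no _)     eq = contradiction (≡.sym eq) (unused _)
  g-injective (no _)    (yes _)    eq = contradiction eq (unused _)
  g-injective (no _)    (no _)     eq = f-injective eq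
  g-class : ∀ {y} (d : Dec (y ≡ x)) → π (g d) ≡ i
  g-class (yes _) = w-class
  g-class (no _)  = f-class _
  g-adj : ∀ {y y′} (d : Dec (y ≡ x)) (d′ : Dec (y′ ≡ x)) → adj G y y′ ≡ true → adj H (g d) (g d′) ≡ true
  g-adj {y′ = y′} (yes refl) _ a = contradiction a (isolated y′)
  g-adj {y = y} (no _) (yes refl) a = contradiction (trans (Graph.sym G x y) a) (isolated y)
  g-adj (no _) (no _) a = f-adj _ _ a

module Copy {G H : Graph} {k} {π : Colouring H k} {i} (s : SubgraphInClass G H π i) where

  embed : Vertex G → Vertex H
  embed = proj₁ s

  embed-injective : Injective _≡_ _≡_ embed
  embed-injective = proj₁ (proj₂ s)

  embed-class : ∀ x → π (embed x) ≡ i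
  embed-class = proj₁ (proj₂ (proj₂ s))

  embed-adj : ∀ x y → adj G x y ≡ true → adj H (embed x) (embed y) ≡ true
  embed-adj = proj₂ (proj₂ (proj₂ s))

-- G and H are taken apart so that their orders are successors: deleteVertex H v then computes, and
-- vertices of G can be punched out.
module Deletion
  {M : ℕ} (adjG : Fin (suc M) → Fin (suc M) → Bool)
  (adjG-sym : ∀ x y → adjG x y ≡ adjG y x) (adjG-irrefl : ∀ x → adjG x x ≡ false)
  {N : ℕ} (adjH : Fin (suc N) → Fin (suc N) → Bool)
  (adjH-sym : ∀ u w → adjH u w ≡ adjH w u) (adjH-irrefl : ∀ u → adjH u u ≡ false)
  (v : Fin (suc N)) where

  G : Graph
  G = record { n = suc M ; adj = adjG ; sym = adjG-sym ; irrefl = adjG-irrefl }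

  H : Graph
  H = record { n = suc N ; adj = adjH ; sym = adjH-sym ; irrefl = adjH-irrefl }

  H∖v : Graph
  H∖v = deleteVertex H v

  extend : ∀ {k} → Colouring H∖v k → Fin k → Colouring H k
  extend σ c u with v ≟ u
  ... | yes _   = c
  ... | no v≢u = σ (punchOut v≢u)

  restrict : ∀ {k} → Colouring H k → Colouring H∖v k
  restrict π = π ∘ punchIn v

  module _ {k} (σ : Colouring H∖v k) (c : Fin k) where

    extend-v : extend σ c v ≡ c
    extend-v with v ≟ v
    ... | yes _   = refl
    ... | no v≢v = contradiction refl v≢v

    extend-≢ : ∀ {u} (v≢u : v ≢ u) → extend σ c u ≡ σ (punchOut v≢u)
    extend-≢ {u} v≢u with v ≟ u
    ... | yes v≡u = contradiction v≡u v≢u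
    ... | no _    = cong σ (punchOut-cong v refl)

    extend-punchIn : ∀ x → extend σ c (punchIn v x) ≡ σ x
    extend-punchIn x = trans (extend-≢ (punchInᵢ≢i v x ∘ ≡.sym)) (cong σ (punchOut-punchIn v))

    colour≢c⇒≢v : ∀ {u i} → extend σ c u ≡ i → i ≢ c → v ≢ u
    colour≢c⇒≢v u-class i≢c refl = i≢c (trans (≡.sym u-class) extend-v)

    copy-avoiding-v : ∀ {i} (s : SubgraphInClass G H (extend σ c) i) →
      (∀ x → v ≢ proj₁ s x) → SubgraphInClass G H∖v σ i
    copy-avoiding-v (f , f-injective , f-class , f-adj) avoids =
      (λ x → punchOut (avoids x)) ,
      (λ eq → f-injective (punchOut-injective (avoids _) (avoids _) eq)) ,
      (λ x → trans (≡.sym (extend-≢ (avoids x))) (f-class x)) ,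
      (λ x y a → subst₂ (λ p q → adjH p q ≡ true)
                   (≡.sym (punchIn-punchOut (avoids x))) (≡.sym (punchIn-punchOut (avoids y)))
                   (f-adj x y a))

  extend-≢-irrelevant : ∀ {k} (σ : Colouring H∖v k) c c′ {u} → v ≢ u → extend σ c u ≡ extend σ c′ u
  extend-≢-irrelevant σ c c′ v≢u = trans (extend-≢ σ c v≢u) (≡.sym (extend-≢ σ c′ v≢u))

  extend-restrict : ∀ {k} (π : Colouring H k) c {u} → v ≢ u → extend (restrict π) c u ≡ π u
  extend-restrict π c v≢u = trans (extend-≢ (restrict π) c v≢u) (cong π (punchIn-punchOut v≢u))

  restrict-GFree : ∀ {k} (π : Colouring H k) → IsGFreeColouring G H π →
    IsGFreeColouring G H∖v (restrict π)
  restrict-GFree π π-free i (f , f-injective , f-class , f-adj) =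
    π-free i (punchIn v ∘ f , f-injective ∘ punchIn-injective v _ _ , f-class , f-adj)

  CopyThroughV : ∀ {k} → Colouring H∖v k → Fin k → Set
  CopyThroughV σ c = Σ (SubgraphInClass G H (extend σ c) c) λ s → ∃ λ x → proj₁ s x ≡ v

  ¬GFree-extend⇒copyThroughV : ∀ {k} {σ : Colouring H∖v k} {c} → IsGFreeColouring G H∖v σ →
    ¬ IsGFreeColouring G H (extend σ c) → ¬ ¬ CopyThroughV σ c
  ¬GFree-extend⇒copyThroughV {σ = σ} {c} σ-free ¬free no-copy = ¬free GFree
    where
    GFree : IsGFreeColouring G H (extend σ c)
    GFree i s@(f , _ , f-class , _) with i ≟ c
    ... | no i≢c = σ-free i (copy-avoiding-v σ c s λ x → colour≢c⇒≢v σ c (f-class x) i≢c)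
    ... | yes refl with any? (λ x → f x ≟ v)
    ...   | yes hit  = no-copy (s , hit)
    ...   | no ¬hit = σ-free c (copy-avoiding-v σ c s λ x v≡fx → ¬hit (x , ≡.sym v≡fx))

  module ThroughV {k} {σ : Colouring H∖v k} {c} (h : CopyThroughV σ c) where
    open Copy {G} {H} {π = extend σ c} (proj₁ h) public

    root : Vertex G
    root = proj₁ (proj₂ h)

    embed-root : embed root ≡ v
    embed-root = proj₂ (proj₂ h)

    embed≢v : ∀ {x} → x ≢ root → v ≢ embed x
    embed≢v x≢root v≡fx = x≢root (embed-injective (trans (≡.sym v≡fx) (≡.sym embed-root)))

  extend-fresh-alone : ∀ {k} {σ : Colouring H∖v k} {c} → (∀ x → σ x ≢ c) →
    ∀ u → extend σ c u ≡ c → u ≡ v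
  extend-fresh-alone σ≢c u u-class with v ≟ u
  ... | yes v≡u = ≡.sym v≡u
  ... | no _    = contradiction u-class (σ≢c _)

  extend-fresh-GFree : 1 ≤ M → ∀ {k} {σ : Colouring H∖v k} {c} → IsGFreeColouring G H∖v σ →
    (∀ x → σ x ≢ c) → IsGFreeColouring G H (extend σ c)
  extend-fresh-GFree 1≤M {σ = σ} {c} σ-free σ≢c i s@(_ , _ , s-class , _) with i ≟ c
  ... | yes refl = contradiction
                     (≤-trans (s≤s 1≤M) (copy-in-singleton⇒≤1 {G} {H} (extend-fresh-alone σ≢c) s))
                     λ { (s≤s ()) }
  ... | no i≢c  = σ-free i (copy-avoiding-v σ c s λ x → colour≢c⇒≢v σ c (s-class x) i≢c)

  deleteVertex-¬colourable : 1 ≤ M → ∀ {k} →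
    (∀ (π : Colouring H k) → IsGFreeColouring G H π → n G < classSize H π v) →
    ∀ j → j < k → ¬ HasGFreeColouring G H∖v j
  deleteVertex-¬colourable 1≤M {k} big-class j j<k (σ , σ-free) =
    contradiction (≤-trans (big-class τ τ-free) (classSize≤1 H τ v alone)) λ { (s≤s ()) }
    where
    σ↑≢fresh : ∀ x → inject≤ (σ x) (<⇒≤ j<k) ≢ fromℕ< j<k
    σ↑≢fresh x = inject≤≢fromℕ< (σ x) j<k
    τ : Colouring H k
    τ = extend (λ x → inject≤ (σ x) (<⇒≤ j<k)) (fromℕ< j<k)
    τ-free : IsGFreeColouring G H τ
    τ-free = extend-fresh-GFree 1≤M (inject≤-GFree {G} {H∖v} zero σ (<⇒≤ j<k) σ-free) σ↑≢fresh
    alone : ∀ u → τ u ≡ τ v → u ≡ v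
    alone u τu≡τv = extend-fresh-alone σ↑≢fresh u (trans τu≡τv (extend-v _ _))

  copiesThroughV⇒degree≥ : ∀ {k δ} {σ : Colouring H∖v k} → (∀ x → δ ≤ degree G x) →
    (∀ c → CopyThroughV σ c) → k * δ ≤ degree H v
  copiesThroughV⇒degree≥ {k} {δ} {σ} δ≤deg copies =
    injective⇒≤countTrue (adjH v) (uncurry F ∘ remQuot {k} δ) (rows-injective F disjoint F-injective)
      (uncurry F-adj ∘ remQuot {k} δ)
    where
    neighbours : ∀ c → Σ (Fin δ → Vertex G) λ f →
      Injective _≡_ _≡_ f × (∀ j → adjG (ThroughV.root (copies c)) (f j) ≡ true)
    neighbours c = ≤countTrue⇒injection (adjG root) (δ≤deg root)
      where open ThroughV (copies c)
    F : Fin k → Fin δ → Vertex H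
    F c j = ThroughV.embed (copies c) (proj₁ (neighbours c) j)
    F-adj : ∀ c j → adjH v (F c j) ≡ true
    F-adj c j = subst (λ u → adjH u (F c j) ≡ true) embed-root
                  (embed-adj root _ (proj₂ (proj₂ (neighbours c)) j))
      where open ThroughV (copies c)
    F≢v : ∀ c j → v ≢ F c j
    F≢v c j v≡F =
      contradiction (trans (≡.sym (adjH-irrefl v)) (trans (cong (adjH v) v≡F) (F-adj c j))) λ ()
    disjoint : ∀ {c c′ j j′} → F c j ≡ F c′ j′ → c ≡ c′
    disjoint {c} {c′} {j} {j′} eq = begin
      c                       ≡⟨ ThroughV.embed-class (copies c) (proj₁ (neighbours c) j) ⟨
      extend σ c  (F c j)     ≡⟨ extend-≢-irrelevant σ c c′ (F≢v c j) ⟩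
      extend σ c′ (F c j)     ≡⟨ cong (extend σ c′) eq ⟩
      extend σ c′ (F c′ j′)   ≡⟨ ThroughV.embed-class (copies c′) (proj₁ (neighbours c′) j′) ⟩
      c′                      ∎
      where open ≡.≡-Reasoning
    F-injective : ∀ c → Injective _≡_ _≡_ (F c)
    F-injective c = proj₁ (proj₂ (neighbours c)) ∘ ThroughV.embed-injective (copies c)

  isolated-v : degree H v ≡ 0 → ∀ w → adjH v w ≢ true
  isolated-v deg≡0 w v~w = contradiction (subst (1 ≤_) deg≡0 one≤deg) λ ()
    where
    one≤deg : 1 ≤ degree H v
    one≤deg = injective⇒≤countTrue (adjH v) (λ _ → w) (λ { {zero} {zero} _ → refl }) λ _ → v~w

  replace-root : ∀ {k} {σ : Colouring H∖v k} {c} → degree H v ≡ 0 → (h : CopyThroughV σ c) →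
    ∀ u → σ u ≡ c → (∀ y → ThroughV.embed h y ≢ punchIn v u) → SubgraphInClass G H∖v σ c
  replace-root {σ = σ} {c} deg≡0 h u σu≡c unused = avoid-v
    (reembed-isolated {G} {H} {π = extend σ c} (proj₁ h) root-isolated
                      (trans (extend-punchIn σ c u) σu≡c) unused)
    where
    open ThroughV h
    root-isolated : ∀ y → adjG root y ≢ true
    root-isolated y a = isolated-v deg≡0 (embed y)
      (subst (λ w → adjH w (embed y) ≡ true) embed-root (embed-adj root y a))
    avoid-v : (Σ (SubgraphInClass G H (extend σ c) c) λ s′ →
                 proj₁ s′ root ≡ punchIn v u × (∀ y → y ≢ root → proj₁ s′ y ≡ embed y)) →
              SubgraphInClass G H∖v σ c
    avoid-v (s′ , s′-root , s′-elsewhere) = copy-avoiding-v σ c s′ λ y → avoids y (y ≟ root)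
      where
      avoids : ∀ y → Dec (y ≡ root) → v ≢ proj₁ s′ y
      avoids y (yes refl)  v≡ = punchInᵢ≢i v u (≡.sym (trans v≡ s′-root))
      avoids y (no y≢root) v≡ = embed≢v y≢root (trans v≡ (s′-elsewhere y y≢root))

  copyThroughV-covers : ∀ {k} {σ : Colouring H∖v k} {c} → degree H v ≡ 0 → IsGFreeColouring G H∖v σ →
    (h : CopyThroughV σ c) → ∀ u → σ u ≡ c → ∃ λ y → ThroughV.embed h y ≡ punchIn v u
  copyThroughV-covers {c = c} deg≡0 σ-free h u σu≡c with any? (λ y → ThroughV.embed h y ≟ punchIn v u)
  ... | yes covered = covered
  ... | no ¬covered = contradiction (replace-root deg≡0 h u σu≡c λ y eq → ¬covered (y , eq)) (σ-free c)

  copiesThroughV⇒size≤ : ∀ {k} {σ : Colouring H∖v k} → degree H v ≡ 0 → IsGFreeColouring G H∖v σ →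
    (∀ c → CopyThroughV σ c) → N ≤ k * M
  copiesThroughV⇒size≤ {k} {σ} deg≡0 σ-free copies = injective⇒≤ {f = λ u → slot u refl} slot-injective
    where
    covers : ∀ {c} u → σ u ≡ c → ∃ λ y → ThroughV.embed (copies c) y ≡ punchIn v u
    covers u = copyThroughV-covers deg≡0 σ-free (copies _) u
    root≢position : ∀ {c} u (σu≡c : σ u ≡ c) → ThroughV.root (copies c) ≢ proj₁ (covers u σu≡c)
    root≢position u σu≡c root≡y = punchInᵢ≢i v u (begin
      punchIn v u                  ≡⟨ proj₂ (covers u σu≡c) ⟨
      embed (proj₁ (covers u σu≡c)) ≡⟨ cong embed root≡y ⟨
      embed root                   ≡⟨ embed-root ⟩
      v                            ∎)
      where open ThroughV (copies _)
            open ≡.≡-Reasoning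
    -- u is encoded by its colour c and its position, other than the root, in the copy through v for c.
    slot : ∀ {c} u → σ u ≡ c → Fin (k * M)
    slot {c} u σu≡c = combine c (punchOut (root≢position u σu≡c))
    slot-injective′ : ∀ {c c′ u u′} (e : σ u ≡ c) (e′ : σ u′ ≡ c′) → slot u e ≡ slot u′ e′ → u ≡ u′
    slot-injective′ {c} {u = u} {u′} e e′ eq with refl , eq′ ← combine-injective c _ _ _ eq =
      punchIn-injective v u u′ (begin
        punchIn v u                  ≡⟨ proj₂ (covers u e) ⟨
        embed (proj₁ (covers u e))   ≡⟨ cong embed (punchOut-injective (root≢position u e)
                                                                       (root≢position u′ e′) eq′) ⟩
        embed (proj₁ (covers u′ e′)) ≡⟨ proj₂ (covers u′ e′) ⟩
        punchIn v u′                 ∎)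
      where open ThroughV (copies c)
            open ≡.≡-Reasoning
    slot-injective : Injective _≡_ _≡_ (λ u → slot u refl)
    slot-injective = slot-injective′ refl refl

  copiesThroughV⇒size≥ : ∀ {k} (π : Colouring H k) (e : Fin (suc (suc M)) → Vertex H) →
    Injective _≡_ _≡_ e → (∀ a → π (e a) ≡ π v) →
    (∀ d → d ≢ π v → CopyThroughV (restrict π) d) → suc (suc (k * M)) ≤ suc N
  copiesThroughV⇒size≥ {k} π e e-injective e-class copies =
    injective⇒≤ {f = e zero ∷ e (suc zero) ∷ flat}
    (∷-injective first-fresh (∷-injective (flat≢e (suc zero) λ _ ()) flat-injective))
    where
    -- Row d lists M vertices of colour d: the last M members of the class of v if d = π v,
    -- and otherwise the vertices other than v of the copy through v for d.
    row : ∀ d → Dec (d ≡ π v) → Fin M → Vertex H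
    row d (yes _)     j = e (suc (suc j))
    row d (no d≢πv) j = embed (punchIn root j)
      where open ThroughV (copies d d≢πv)
    row-class : ∀ d (d≟πv : Dec (d ≡ π v)) j → π (row d d≟πv j) ≡ d
    row-class d (yes d≡πv) j = trans (e-class _) (≡.sym d≡πv)
    row-class d (no d≢πv)  j = trans (≡.sym (extend-restrict π d (embed≢v (punchInᵢ≢i root j))))
                                      (embed-class (punchIn root j))
      where open ThroughV (copies d d≢πv)
    row-injective : ∀ d (d≟πv : Dec (d ≡ π v)) → Injective _≡_ _≡_ (row d d≟πv)
    row-injective d (yes _)    = suc-injective ∘ suc-injective ∘ e-injective
    row-injective d (no d≢πv) = punchIn-injective root _ _ ∘ embed-injective
      where open ThroughV (copies d d≢πv)
    F : Fin k → Fin M → Vertex H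
    F d = row d (d ≟ π v)
    flat : Fin (k * M) → Vertex H
    flat = uncurry F ∘ remQuot {k} M
    flat-injective : Injective _≡_ _≡_ flat
    flat-injective = rows-injective F
      (λ {d} {d′} {j} {j′} eq →
        trans (≡.sym (row-class d (d ≟ π v) j)) (trans (cong π eq) (row-class d′ (d′ ≟ π v) j′)))
      (λ d → row-injective d (d ≟ π v))
    row≢e : ∀ a → (∀ j → a ≢ suc (suc j)) → ∀ d (d≟πv : Dec (d ≡ π v)) j → row d d≟πv j ≢ e a
    row≢e a a-early d (yes _)    j eq = a-early j (e-injective (≡.sym eq))
    row≢e a a-early d (no d≢πv) j eq =
      d≢πv (trans (≡.sym (row-class d (no d≢πv) j)) (trans (cong π eq) (e-class a)))
    flat≢e : ∀ a → (∀ j → a ≢ suc (suc j)) → ∀ i → flat i ≢ e a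
    flat≢e a a-early i = uncurry (λ d → row≢e a a-early d (d ≟ π v)) (remQuot {k} M i)
    first-fresh : ∀ i → (e (suc zero) ∷ flat) i ≢ e zero
    first-fresh zero    eq = contradiction (e-injective eq) λ ()
    first-fresh (suc i) = flat≢e zero (λ _ ()) i

  module Uniqueness {k} (k≥1 : 1 ≤ k) (U : UniquelyGFreeColourable G H k)
    (big-class : ∀ (π : Colouring H k) → IsGFreeColouring G H π → n G < classSize H π v) where

    π : Colouring H k
    π = proj₁ (proj₁ (proj₁ U))

    π-free : IsGFreeColouring G H π
    π-free = proj₂ (proj₁ (proj₁ U))

    samePartition : ∀ (τ τ′ : Colouring H k) → IsGFreeColouring G H τ → IsGFreeColouring G H τ′ →
      ∀ u w → τ u ≡ τ w → τ′ u ≡ τ′ w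
    samePartition τ τ′ τ-free τ′-free u w = proj₁ (proj₂ U τ τ′ τ-free τ′-free u w)

    open ≡.≡-Reasoning

    πv-members : Σ (Fin (suc (suc M)) → Vertex H) λ e → Injective _≡_ _≡_ e × (∀ a → π (e a) ≡ π v)
    πv-members = classMembers H π v (big-class π π-free)

    classmate : Σ (Vertex H) λ w → v ≢ w × π w ≡ π v
    classmate = let e , e-injective , e-class = πv-members
                    a , v≢ea = injective-avoids e e-injective v
                in e a , v≢ea , e-class a

    extend-restrict-¬GFree : ∀ {d} → d ≢ π v → ¬ IsGFreeColouring G H (extend (restrict π) d)
    extend-restrict-¬GFree {d} d≢πv τ-free with w , v≢w , πw≡πv ← classmate = d≢πv (begin
      d                       ≡⟨ extend-v (restrict π) d ⟨
      extend (restrict π) d v ≡⟨ samePartition π (extend (restrict π) d) π-free τ-free w v πw≡πv ⟨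
      extend (restrict π) d w ≡⟨ extend-restrict π d v≢w ⟩
      π w                     ≡⟨ πw≡πv ⟩
      π v                     ∎)

    copiesThroughV-restrict : ¬ ¬ (∀ d → d ≢ π v → CopyThroughV (restrict π) d)
    copiesThroughV-restrict = ¬¬-Π-Fin k λ d → copyThroughV-if (d ≟ π v)
      where
      copyThroughV-if : ∀ {d} → Dec (d ≡ π v) → ¬ ¬ (d ≢ π v → CopyThroughV (restrict π) d)
      copyThroughV-if (yes d≡πv) none = none λ d≢πv → contradiction d≡πv d≢πv
      copyThroughV-if (no d≢πv) = ¬¬-map (λ copy _ → copy)
        (¬GFree-extend⇒copyThroughV (restrict-GFree π π-free) (extend-restrict-¬GFree d≢πv))

    noCopiesThroughV : ∀ {σ : Colouring H∖v k} → IsGFreeColouring G H∖v σ →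
      ∀ δ → (∀ x → δ ≤ degree G x) → degree H v ≡ (k ∸ 1) * δ → ¬ (∀ c → CopyThroughV σ c)
    noCopiesThroughV σ-free zero _ deg-v copies = copiesThroughV-restrict λ copiesπ →
      let e , e-injective , e-class = πv-members in
      1+n≰n (≤-trans (copiesThroughV⇒size≥ π e e-injective e-class copiesπ)
                     (s≤s (copiesThroughV⇒size≤ (trans deg-v (*-zeroʳ (k ∸ 1))) σ-free copies)))
    noCopiesThroughV σ-free (suc δ) δ≤deg deg-v copies =
      <⇒≱ (*-pred-< δ k≥1) (subst (k * suc δ ≤_) deg-v (copiesThroughV⇒degree≥ δ≤deg copies))

    module _ {δ} (δ≤deg : ∀ x → δ ≤ degree G x) (deg-v : degree H v ≡ (k ∸ 1) * δ) where

      extendable : ∀ {σ : Colouring H∖v k} → IsGFreeColouring G H∖v σ →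
        ¬ ¬ ∃ λ c → IsGFreeColouring G H (extend σ c)
      extendable σ-free no-extension = ¬¬-Π-Fin k
        (λ c → ¬GFree-extend⇒copyThroughV σ-free (no-extension ∘ (c ,_)))
        (noCopiesThroughV σ-free δ δ≤deg deg-v)

      -- Colour equality is decidable, so an extendable colour need only exist classically.
      deleteVertex-samePartition : ∀ {σ σ′ : Colouring H∖v k} →
        IsGFreeColouring G H∖v σ → IsGFreeColouring G H∖v σ′ → ∀ u w → σ u ≡ σ w → σ′ u ≡ σ′ w
      deleteVertex-samePartition {σ} {σ′} σ-free σ′-free u w σu≡σw =
        decidable-stable (σ′ u ≟ σ′ w) λ σ′u≢σ′w →
        extendable σ-free λ (c , τ-free) → extendable σ′-free λ (c′ , τ′-free) →
        σ′u≢σ′w (begin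
          σ′ u                        ≡⟨ extend-punchIn σ′ c′ u ⟨
          extend σ′ c′ (punchIn v u)  ≡⟨ samePartition (extend σ c) (extend σ′ c′) τ-free τ′-free
                                                        (punchIn v u) (punchIn v w) (begin
            extend σ c (punchIn v u)    ≡⟨ extend-punchIn σ c u ⟩
            σ u                         ≡⟨ σu≡σw ⟩
            σ w                         ≡⟨ extend-punchIn σ c w ⟨
            extend σ c (punchIn v w)    ∎) ⟩
          extend σ′ c′ (punchIn v w)  ≡⟨ extend-punchIn σ′ c′ w ⟩
          σ′ w                        ∎)

theorem10 : (G H : Graph) (k : ℕ) → 2 ≤ n G → 1 ≤ k →
    UniquelyGFreeColourable G H k →
    (δ : ℕ) → IsMinDegree G δ →
    (v : Vertex H) → degree H v ≡ (k ∸ 1) * δ →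
    (∀ (π : Colouring H k) → IsGFreeColouring G H π → n G < classSize H π v) →
    UniquelyGFreeColourable G (deleteVertex H v) k
theorem10 record { n = suc M ; adj = adjG ; sym = adjG-sym ; irrefl = adjG-irrefl }
          record { n = suc N ; adj = adjH ; sym = adjH-sym ; irrefl = adjH-irrefl }
          k (s≤s 1≤M) k≥1 U δ (δ≤deg , _) v deg-v big-class =
  ((restrict π , restrict-GFree π π-free) , deleteVertex-¬colourable 1≤M big-class) ,
  λ σ σ′ σ-free σ′-free u w →
    deleteVertex-samePartition δ≤deg deg-v σ-free σ′-free u w ,
    deleteVertex-samePartition δ≤deg deg-v σ′-free σ-free u w
  where
  open Deletion adjG adjG-sym adjG-irrefl adjH adjH-sym adjH-irrefl v
  open Uniqueness k≥1 U big-class
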